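{- Let $L$ be a residuated lattice, $n\geq 1$ an integer, and $F$ a filter of $L$. The following conditions are equivalent: (i) $F$ is an $n$-fold implicative filter of $L$; (ii) $x^n\rightarrow x^{2n}\in F$ for all $x\in L$; (iii) for all $x,y\in L$, if $x^{n+1}\rightarrow y\in F$ then $x^n\rightarrow y\in F$; (iv) for all $x,y,z\in L$, if $x^n\rightarrow(y\rightarrow z)\in F$ then $(x^n\rightarrow y)\rightarrow(x^n\rightarrow z)\in F$.
   Context: A residuated lattice is an algebra $(L,\wedge,\vee,\otimes,\rightarrow,0,1)$ such that $(L,\wedge,\vee,0,1)$ is a bounded lattice, $(L,\otimes,1)$ is a commutative monoid, and $x\otimes y\leq z$ iff $x\leq y\rightarrow z$. A filter of $L$ is a nonempty subset closed under $\otimes$ and upward closed. For $x\in L$ and $k\geq1$, $x^k=x\otimes\cdots\otimes x$ ($k$ factors). A subset $F\subseteq L$ is an $n$-fold implicative filter if $1\in F$ and for all $x,y,z\in L$: $x^n\rightarrow(y\rightarrow z)\in F$ and $x^n\rightarrow y\in F$ imply $x^n\rightarrow z\in F$. -}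

module Defs where

open import Level using (Level; suc; _⊔_)
open import Data.Nat using (ℕ; zero) renaming (suc to 1+)
open import Data.Product using (Σ; _×_)
open import Relation.Binary.PropositionalEquality using (_≡_)
open import Function.Bundles using (_⇔_)

record ResiduatedLattice (c : Level) : Set (suc c) where
  infixr 5 _⇒_
  infixl 7 _⊗_
  infixl 6 _∧_
  infixl 6 _∨_
  field
    Carrier : Set c
    _∧_ _∨_ _⊗_ _⇒_ : Carrier → Carrier → Carrier
    𝟘 𝟙 : Carrier
    ∧-comm   : ∀ x y → x ∧ y ≡ y ∧ x
    ∧-assoc  : ∀ x y z → (x ∧ y) ∧ z ≡ x ∧ (y ∧ z)
    ∨-comm   : ∀ x y → x ∨ y ≡ y ∨ x
    ∨-assoc  : ∀ x y z → (x ∨ y) ∨ z ≡ x ∨ (y ∨ z)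
    ∧-absorbs-∨ : ∀ x y → x ∧ (x ∨ y) ≡ x
    ∨-absorbs-∧ : ∀ x y → x ∨ (x ∧ y) ≡ x
    𝟘-least  : ∀ x → 𝟘 ∧ x ≡ 𝟘
    𝟙-greatest : ∀ x → x ∧ 𝟙 ≡ x
    ⊗-comm   : ∀ x y → x ⊗ y ≡ y ⊗ x
    ⊗-assoc  : ∀ x y z → (x ⊗ y) ⊗ z ≡ x ⊗ (y ⊗ z)
    ⊗-identityˡ : ∀ x → 𝟙 ⊗ x ≡ x

  infix 4 _≤_
  _≤_ : Carrier → Carrier → Set c
  x ≤ y = x ∧ y ≡ x

  field
    residuated : ∀ x y z → (x ⊗ y ≤ z) ⇔ (x ≤ y ⇒ z)

  -- x ^ k = x ⊗ ⋯ ⊗ x (k factors), for k ≥ 1; we set x ^ 0 = 1.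
  _^_ : Carrier → ℕ → Carrier
  x ^ zero = 𝟙
  x ^ 1+ zero = x
  x ^ 1+ (1+ k) = x ⊗ (x ^ 1+ k)

module _ {c : Level} (L : ResiduatedLattice c) where
  open ResiduatedLattice L

  record IsFilter {ℓ : Level} (F : Carrier → Set ℓ) : Set (c ⊔ ℓ) where
    field
      nonempty : Σ Carrier F
      ⊗-closed : ∀ {x y} → F x → F y → F (x ⊗ y)
      up-closed : ∀ {x y} → x ≤ y → F x → F y

  IsNFoldImplicativeFilter : {ℓ : Level} → ℕ → (Carrier → Set ℓ) → Set (c ⊔ ℓ)
  IsNFoldImplicativeFilter n F =
    F 𝟙 × (∀ x y z → F (x ^ n ⇒ (y ⇒ z)) → F (x ^ n ⇒ y) → F (x ^ n ⇒ z))

-- The four conditions form the cycle (i) ⇒ (iii) ⇒ (ii) ⇒ (iv) ⇒ (i).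
-- For (i) ⇒ (iii), instantiate (i) at y := x and use x ^ n ≤ x.  For (iii) ⇒ (ii),
-- absorb the surplus factors of x ^ (2n) ⇒ x ^ (2n) one at a time.  For
-- (ii) ⇒ (iv), note that a ⇒ (y ⇒ z) ≤ (a ⊗ a) ⇒ ((a ⇒ y) ⇒ z) holds in every
-- residuated lattice; (ii) says exactly that a := x ^ n may be duplicated inside F,
-- i.e. a ⇒ a ⊗ a ∈ F.  Finally (iv) ⇒ (i) is modus ponens.
module Submission where

open import Defs
open import Level using (Level; _⊔_)
open import Data.Nat using (ℕ; zero; suc; _≤_; _+_; _*_)
open import Data.Nat.Properties using (+-identityʳ; +-assoc)
open import Data.Product using (_×_; _,_; proj₁; proj₂)
open import Function using (_∘_)
open import Function.Bundles using (_⇔_; mk⇔; Equivalence)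
open import Relation.Binary.PropositionalEquality
  using (_≡_; refl; sym; trans; cong; subst)
open Relation.Binary.PropositionalEquality.≡-Reasoning

module ResiduatedLatticeProperties {c : Level} (L : ResiduatedLattice c) where
  open ResiduatedLattice L renaming (_≤_ to _≼_)

  ≼-refl : ∀ {x} → x ≼ x
  ≼-refl {x} = trans (cong (x ∧_) (sym (∨-absorbs-∧ x x))) (∧-absorbs-∨ x (x ∧ x))

  ≼-trans : ∀ {x y z} → x ≼ y → y ≼ z → x ≼ z
  ≼-trans {x} {y} {z} x≼y y≼z = begin
    x ∧ z        ≡⟨ cong (_∧ z) (sym x≼y) ⟩
    (x ∧ y) ∧ z  ≡⟨ ∧-assoc x y z ⟩
    x ∧ (y ∧ z)  ≡⟨ cong (x ∧_) y≼z ⟩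
    x ∧ y        ≡⟨ x≼y ⟩
    x            ∎

  ≡⇒≼ : ∀ {x y} → x ≡ y → x ≼ y
  ≡⇒≼ refl = ≼-refl

  ⇒-intro : ∀ {x y z} → x ⊗ y ≼ z → x ≼ y ⇒ z
  ⇒-intro {x} {y} {z} = Equivalence.to (residuated x y z)

  ⇒-elim : ∀ {x y z} → x ≼ y ⇒ z → x ⊗ y ≼ z
  ⇒-elim {x} {y} {z} = Equivalence.from (residuated x y z)

  modus-ponensˡ : ∀ {y z} → (y ⇒ z) ⊗ y ≼ z
  modus-ponensˡ = ⇒-elim ≼-refl

  modus-ponensʳ : ∀ {y z} → y ⊗ (y ⇒ z) ≼ z
  modus-ponensʳ {y} {z} = ≼-trans (≡⇒≼ (⊗-comm y (y ⇒ z))) modus-ponensˡ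

  ⊗-monoˡ-≼ : ∀ {x y z} → x ≼ y → x ⊗ z ≼ y ⊗ z
  ⊗-monoˡ-≼ x≼y = ⇒-elim (≼-trans x≼y (⇒-intro ≼-refl))

  ⊗-monoʳ-≼ : ∀ {x y z} → x ≼ y → z ⊗ x ≼ z ⊗ y
  ⊗-monoʳ-≼ {x} {y} {z} x≼y =
    ≼-trans (≡⇒≼ (⊗-comm z x)) (≼-trans (⊗-monoˡ-≼ x≼y) (≡⇒≼ (⊗-comm y z)))

  ⊗-mono-≼ : ∀ {x y u v} → x ≼ y → u ≼ v → x ⊗ u ≼ y ⊗ v
  ⊗-mono-≼ x≼y u≼v = ≼-trans (⊗-monoˡ-≼ x≼y) (⊗-monoʳ-≼ u≼v)

  ⊗-identityʳ : ∀ x → x ⊗ 𝟙 ≡ x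
  ⊗-identityʳ x = trans (⊗-comm x 𝟙) (⊗-identityˡ x)

  ⊗-decreasingˡ : ∀ x y → x ⊗ y ≼ x
  ⊗-decreasingˡ x y = ≼-trans (⊗-monoʳ-≼ (𝟙-greatest y)) (≡⇒≼ (⊗-identityʳ x))

  ≼⇒𝟙≼⇒ : ∀ {x y} → x ≼ y → 𝟙 ≼ x ⇒ y
  ≼⇒𝟙≼⇒ {x} x≼y = ⇒-intro (≼-trans (≡⇒≼ (⊗-identityˡ x)) x≼y)

  ⇒-curry : ∀ {a b z} → (a ⊗ b) ⇒ z ≼ a ⇒ (b ⇒ z)
  ⇒-curry {a} {b} = ⇒-intro (⇒-intro (≼-trans (≡⇒≼ (⊗-assoc _ a b)) modus-ponensˡ))

  ⇒-uncurry : ∀ {a b z} → a ⇒ (b ⇒ z) ≼ (a ⊗ b) ⇒ z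
  ⇒-uncurry {a} {b} = ⇒-intro (≼-trans (≡⇒≼ (sym (⊗-assoc _ a b)))
    (⇒-elim modus-ponensˡ))

  ⇒-exchange : ∀ {a b z} → a ⇒ (b ⇒ z) ≼ b ⇒ (a ⇒ z)
  ⇒-exchange {a} {b} {z} = ⇒-intro (⇒-intro (≼-trans (≡⇒≼ swap) (⇒-elim modus-ponensˡ)))
    where
    p = a ⇒ (b ⇒ z)
    swap : (p ⊗ b) ⊗ a ≡ (p ⊗ a) ⊗ b
    swap = begin
      (p ⊗ b) ⊗ a  ≡⟨ ⊗-assoc p b a ⟩
      p ⊗ (b ⊗ a)  ≡⟨ cong (p ⊗_) (⊗-comm b a) ⟩
      p ⊗ (a ⊗ b)  ≡⟨ sym (⊗-assoc p a b) ⟩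
      (p ⊗ a) ⊗ b  ∎

  ⇒-compose : ∀ {a b z} → (a ⇒ b) ⊗ (b ⇒ z) ≼ a ⇒ z
  ⇒-compose {a} {b} {z} = ⇒-intro (≼-trans (≡⇒≼ reorder)
    (≼-trans (⊗-monoʳ-≼ modus-ponensˡ) modus-ponensˡ))
    where
    reorder : ((a ⇒ b) ⊗ (b ⇒ z)) ⊗ a ≡ (b ⇒ z) ⊗ ((a ⇒ b) ⊗ a)
    reorder = trans (cong (_⊗ a) (⊗-comm (a ⇒ b) (b ⇒ z))) (⊗-assoc (b ⇒ z) (a ⇒ b) a)

  -- Frege's axiom (a → y → z) → (a → y) → (a → z), paying for the second use of a.
  frege-≼ : ∀ {a y z} → a ⇒ (y ⇒ z) ≼ (a ⊗ a) ⇒ ((a ⇒ y) ⇒ z)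
  frege-≼ {a} {y} {z} = ⇒-intro (⇒-intro (≼-trans (≡⇒≼ regroup)
    (≼-trans (⊗-mono-≼ modus-ponensˡ modus-ponensʳ) modus-ponensˡ)))
    where
    p = a ⇒ (y ⇒ z)
    r = a ⇒ y
    regroup : (p ⊗ (a ⊗ a)) ⊗ r ≡ (p ⊗ a) ⊗ (a ⊗ r)
    regroup = trans (cong (_⊗ r) (sym (⊗-assoc p a a))) (⊗-assoc (p ⊗ a) a r)

  ^-suc : ∀ x k → x ^ suc k ≡ x ⊗ x ^ k
  ^-suc x zero    = sym (⊗-identityʳ x)
  ^-suc x (suc k) = refl

  ^-+ : ∀ x m k → x ^ (m + k) ≡ x ^ m ⊗ x ^ k
  ^-+ x zero    k = sym (⊗-identityˡ _)
  ^-+ x (suc m) k = begin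
    x ^ suc (m + k)        ≡⟨ ^-suc x (m + k) ⟩
    x ⊗ x ^ (m + k)        ≡⟨ cong (x ⊗_) (^-+ x m k) ⟩
    x ⊗ (x ^ m ⊗ x ^ k)    ≡⟨ sym (⊗-assoc x _ _) ⟩
    (x ⊗ x ^ m) ⊗ x ^ k    ≡⟨ cong (_⊗ x ^ k) (sym (^-suc x m)) ⟩
    x ^ suc m ⊗ x ^ k      ∎

  ^-double : ∀ x n → x ^ (2 * n) ≡ x ^ n ⊗ x ^ n
  ^-double x n = trans (cong (λ k → x ^ (n + k)) (+-identityʳ n)) (^-+ x n n)

  ^-≼ : ∀ x {n} → 1 ≤ n → x ^ n ≼ x
  ^-≼ x {suc k} _ = ≼-trans (≡⇒≼ (^-suc x k)) (⊗-decreasingˡ x (x ^ k))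

  module FilterProperties {ℓ : Level} {F : Carrier → Set ℓ} (isFilter : IsFilter L F) where
    open IsFilter isFilter

    𝟙∈F : F 𝟙
    𝟙∈F = up-closed (𝟙-greatest (proj₁ nonempty)) (proj₂ nonempty)

    ⊗-closed-≼ : ∀ {p q r} → F p → F q → p ⊗ q ≼ r → F r
    ⊗-closed-≼ p∈F q∈F p⊗q≼r = up-closed p⊗q≼r (⊗-closed p∈F q∈F)

    modus-ponens : ∀ {u v} → F u → F (u ⇒ v) → F v
    modus-ponens u∈F u⇒v∈F = ⊗-closed-≼ u∈F u⇒v∈F modus-ponensʳ

    ≼⇒⇒∈F : ∀ {x y} → x ≼ y → F (x ⇒ y)
    ≼⇒⇒∈F x≼y = up-closed (≼⇒𝟙≼⇒ x≼y) 𝟙∈F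

    ⇒-trans-∈F : ∀ {a b z} → F (a ⇒ b) → F (b ⇒ z) → F (a ⇒ z)
    ⇒-trans-∈F a⇒b∈F b⇒z∈F = ⊗-closed-≼ a⇒b∈F b⇒z∈F ⇒-compose

    frege-∈F : ∀ {a y z} → F (a ⇒ a ⊗ a) → F (a ⇒ (y ⇒ z)) → F ((a ⇒ y) ⇒ (a ⇒ z))
    frege-∈F dup f = up-closed ⇒-exchange (⇒-trans-∈F dup (up-closed frege-≼ f))

    module NFold (n : ℕ) (1≤n : 1 ≤ n) where
      Implicative : Set (c ⊔ ℓ)
      Implicative = IsNFoldImplicativeFilter L n F

      Doubling : Set (c ⊔ ℓ)
      Doubling = ∀ x → F (x ^ n ⇒ x ^ (2 * n))

      Absorbing : Set (c ⊔ ℓ)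
      Absorbing = ∀ x y → F (x ^ (n + 1) ⇒ y) → F (x ^ n ⇒ y)

      Distributive : Set (c ⊔ ℓ)
      Distributive = ∀ x y z → F (x ^ n ⇒ (y ⇒ z)) → F ((x ^ n ⇒ y) ⇒ (x ^ n ⇒ z))

      implicative⇒absorbing : Implicative → Absorbing
      implicative⇒absorbing (_ , implicative) x y x^[n+1]⇒y∈F = implicative x x y
        (up-closed ⇒-curry (subst F (cong (_⇒ y) (^-+ x n 1)) x^[n+1]⇒y∈F))
        (≼⇒⇒∈F (^-≼ x 1≤n))

      absorbing-iterate : Absorbing → ∀ x j y → F (x ^ (n + j) ⇒ y) → F (x ^ n ⇒ y)
      absorbing-iterate absorb x zero y h =
        subst F (cong (λ k → x ^ k ⇒ y) (+-identityʳ n)) h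
      absorbing-iterate absorb x (suc j) y h =
        absorbing-iterate absorb x j y
          (subst F (cong (_⇒ y) (sym (^-+ x n j)))
            (up-closed ⇒-uncurry (absorb x (x ^ j ⇒ y) (up-closed ⇒-curry
              (subst F (cong (_⇒ y) split) h)))))
        where
        split : x ^ (n + suc j) ≡ x ^ (n + 1) ⊗ x ^ j
        split = trans (cong (x ^_) (sym (+-assoc n 1 j))) (^-+ x (n + 1) j)

      absorbing⇒doubling : Absorbing → Doubling
      absorbing⇒doubling absorb x = absorbing-iterate absorb x n (x ^ (2 * n))
        (≼⇒⇒∈F (≡⇒≼ (cong (λ k → x ^ (n + k)) (sym (+-identityʳ n)))))

      doubling⇒distributive : Doubling → Distributive
      doubling⇒distributive double x y z =
        frege-∈F (subst F (cong (x ^ n ⇒_) (^-double x n)) (double x))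

      distributive⇒implicative : Distributive → Implicative
      distributive⇒implicative distribute =
        𝟙∈F , λ x y z f g → modus-ponens g (distribute x y z f)

proposition4p7 : {c ℓ : Level} (L : ResiduatedLattice c) (n : ℕ) → 1 ≤ n →
    (F : ResiduatedLattice.Carrier L → Set ℓ) → IsFilter L F →
    let open ResiduatedLattice L in
    let cI = IsNFoldImplicativeFilter L n F in
    let cII = ∀ x → F (x ^ n ⇒ x ^ (2 * n)) in
    let cIII = ∀ x y → F (x ^ (n + 1) ⇒ y) → F (x ^ n ⇒ y) in
    let cIV = ∀ x y z → F (x ^ n ⇒ (y ⇒ z)) → F ((x ^ n ⇒ y) ⇒ (x ^ n ⇒ z)) in
    (cI ⇔ cII) × (cI ⇔ cIII) × (cI ⇔ cIV)
proposition4p7 L n 1≤n F isFilter =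
  mk⇔ (iii⇒ii ∘ i⇒iii) (iv⇒i ∘ ii⇒iv) ,
  mk⇔ i⇒iii (iv⇒i ∘ ii⇒iv ∘ iii⇒ii) ,
  mk⇔ (ii⇒iv ∘ iii⇒ii ∘ i⇒iii) iv⇒i
  where
  open ResiduatedLatticeProperties L
  open FilterProperties isFilter
  open NFold n 1≤n
    renaming ( implicative⇒absorbing to i⇒iii ; absorbing⇒doubling to iii⇒ii
             ; doubling⇒distributive to ii⇒iv ; distributive⇒implicative to iv⇒i )
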